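{- For all computation combinations $D, D'$ (terms of class $D$ of the CPS grammar), if $D \to_{l\cup\beta} D'$ then $\overline{D}\to_{a\cup\beta}^{*}\overline{D'}$.
   Context: Syntax. Fix a ring of scalars; $\alpha,\beta$ range over it. Terms: $M,N,L ::= V \mid MN \mid \alpha.M \mid M+N$; values $V,W ::= B \mid 0 \mid \alpha.V \mid V+W$; base values $B ::= x \mid \lambda x.M$. Terms are taken up to $\alpha$-conversion, $M[x:=N]$ is capture-avoiding substitution; application associates left and binds tighter than $+$ and $\alpha.$. Rewrite rules. $(\beta_n)$: $(\lambda x.M)N \to M[x:=N]$. $(A)$: $(M+N)L \to ML+NL$; $(\alpha.M)N \to \alpha.(MN)$; $(0)M \to 0$. $(\beta_v)$: $(\lambda x.M)B \to M[x:=B]$, $B$ a base value. $(\xi_{\lambda_{lin}})$: if $M\to M'$ then $VM \to VM'$, $V$ a value. $(A_l)$: $(M+N)V \to MV+NV$; $(\alpha.M)V \to \alpha.(MV)$; $(0)V \to 0$, $V$ a value. $(A_r)$: $B(M+N)\to BM+BN$; $B(\alpha.M)\to \alpha.(BM)$; $B(0)\to 0$, $B$ a base value. $(L)$: $M+(N+L)\to(M+N)+L$; $(M+N)+L\to M+(N+L)$; $M+N\to N+M$; $\alpha.M+\beta.M\to(\alpha+\beta).M$; $\alpha.M+M\to(\alpha+1).M$; $M+M\to(1+1).M$; $\alpha.(\beta.M)\to(\alpha\beta).M$; $\alpha.(M+N)\to\alpha.M+\alpha.N$; $1.M\to M$; $0.M\to 0$; $\alpha.0\to 0$; $0+M\to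 M$. $(\xi)$: if $M\to M'$ then $MN\to M'N$, $M+N\to M'+N$, $N+M\to N+M'$, $\alpha.M\to\alpha.M'$. A union of rules denotes the generated relation, context rules applying to the relation being defined: $\to_{\beta_n} ::= \beta_n\cup\xi$; $\to_a ::= A\cup L\cup\xi$; $\to_{\beta_v} ::= \beta_v\cup\xi\cup\xi_{\lambda_{lin}}$; $\to_l ::= A_l\cup A_r\cup L\cup\xi\cup\xi_{\lambda_{lin}}$; $\to_{l\cup\beta} ::= \to_l\cup\to_{\beta_v}$; $\to_{a\cup\beta} ::= \to_a\cup\to_{\beta_n}$; $\to^{*}$ is reflexive-transitive closure. CPS grammar (a subset of terms). Base computations $C ::= KB \mid BSK \mid TK$; computation combinations $D ::= C \mid 0 \mid \alpha.D \mid D_1+D_2$; base suspensions $S ::= x \mid \lambda k.C$; suspension combinations $T ::= S \mid 0 \mid \alpha.T \mid T_1+T_2$; continuations $K ::= k \mid \lambda b.bSK$; CPS-values $B ::= \lambda x.S$. Here $x$ ranges over ordinary variables, $k,b$ are reserved variables; $k$ occurs only as the continuation $k$ and as the binder in $\lambda k.C$; $b$ occurs only where displayed. Inverse translation: $\overline{KB}=\underline{K}[\phi(B)]$; $\overline{BSK}=\underline{K}[\phi(B)\sigma(S)]$; $\overline{TK}=\underline{K}[\sigma(T)]$; $\overline{0}=0$; $\overline{\alpha.D}=\alpha.\overline{D}$; $\overline{D_1+D_2}=\overline{D_1}+\overline{D_2}$; $\sigma(x)=x$; $\sigma(\lambda k.C)=\overline{C}$; $\sigma(0)=0$; $\sigma(\alpha.T)=\alpha.\sigma(T)$;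 $\sigma(T_1+T_2)=\sigma(T_1)+\sigma(T_2)$; $\phi(\lambda x.S)=\lambda x.\sigma(S)$; for a term $M$: $\underline{k}[M]=M$; $\underline{\lambda b.bSK}[M]=\underline{K}[M\,\sigma(S)]$. -}

module Defs where

open import Level using (_⊔_)
open import Data.Nat using (ℕ; zero; suc)
open import Data.List using (List; []; _∷_)
open import Data.Sum using (_⊎_)
open import Algebra.Bundles using (Ring)
open import Relation.Binary.PropositionalEquality using (_≡_)
open import Relation.Binary.Construct.Closure.ReflexiveTransitive using (Star)

-- The calculus is parameterised by the ring of scalars.
-- Terms are de Bruijn-indexed (this realises "terms up to α-conversion").
module Lambda {c ℓ} (R : Ring c ℓ) where

  open Ring R using (Carrier; _+_; _*_; 0#; 1#)

  infixl 7 _∙_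
  infixl 6 _·_
  infixl 5 _⊕_

  data Term : Set c where
    var  : ℕ → Term
    lam  : Term → Term
    _∙_  : Term → Term → Term
    zer  : Term
    _·_  : Carrier → Term → Term
    _⊕_  : Term → Term → Term

  data IsBase : Term → Set c where
    var : ∀ i → IsBase (var i)
    lam : ∀ M → IsBase (lam M)

  data IsValue : Term → Set c where
    base : ∀ {B} → IsBase B → IsValue B
    zer  : IsValue zer
    scal : ∀ α {V} → IsValue V → IsValue (α · V)
    plus : ∀ {V W} → IsValue V → IsValue W → IsValue (V ⊕ W)

  ext : (ℕ → ℕ) → ℕ → ℕ
  ext ρ zero    = zero
  ext ρ (suc i) = suc (ρ i)

  rename : (ℕ → ℕ) → Term → Term
  rename ρ (var i) = var (ρ i)
  rename ρ (lam M) = lam (rename (ext ρ) M)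
  rename ρ (M ∙ N) = rename ρ M ∙ rename ρ N
  rename ρ zer     = zer
  rename ρ (α · M) = α · rename ρ M
  rename ρ (M ⊕ N) = rename ρ M ⊕ rename ρ N

  exts : (ℕ → Term) → ℕ → Term
  exts σ zero    = var zero
  exts σ (suc i) = rename suc (σ i)

  subst : (ℕ → Term) → Term → Term
  subst σ (var i) = σ i
  subst σ (lam M) = lam (subst (exts σ) M)
  subst σ (M ∙ N) = subst σ M ∙ subst σ N
  subst σ zer     = zer
  subst σ (α · M) = α · subst σ M
  subst σ (M ⊕ N) = subst σ M ⊕ subst σ N

  σ₀ : Term → ℕ → Term
  σ₀ N zero    = N
  σ₀ N (suc i) = var i

  -- M [ N ] is  M[x := N]  where x is the variable bound by the λ around M
  _[_] : Term → Term → Term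
  M [ N ] = subst (σ₀ N) M

  Rel : Set (Level.suc c)
  Rel = Term → Term → Set c

  data Rβn : Rel where
    βn : ∀ M N → Rβn (lam M ∙ N) (M [ N ])

  data RA : Rel where
    A-plus : ∀ M N L → RA ((M ⊕ N) ∙ L) ((M ∙ L) ⊕ (N ∙ L))
    A-scal : ∀ α M N → RA ((α · M) ∙ N) (α · (M ∙ N))
    A-zer  : ∀ M → RA (zer ∙ M) zer

  data Rβv : Rel where
    βv : ∀ M {B} → IsBase B → Rβv (lam M ∙ B) (M [ B ])

  data RAl : Rel where
    Al-plus : ∀ M N {V} → IsValue V → RAl ((M ⊕ N) ∙ V) ((M ∙ V) ⊕ (N ∙ V))
    Al-scal : ∀ α M {V} → IsValue V → RAl ((α · M) ∙ V) (α · (M ∙ V))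
    Al-zer  : ∀ {V} → IsValue V → RAl (zer ∙ V) zer

  data RAr : Rel where
    Ar-plus : ∀ {B} → IsBase B → ∀ M N → RAr (B ∙ (M ⊕ N)) ((B ∙ M) ⊕ (B ∙ N))
    Ar-scal : ∀ {B} → IsBase B → ∀ α M → RAr (B ∙ (α · M)) (α · (B ∙ M))
    Ar-zer  : ∀ {B} → IsBase B → RAr (B ∙ zer) zer

  data RL : Rel where
    L-assocʳ : ∀ M N L → RL (M ⊕ (N ⊕ L)) ((M ⊕ N) ⊕ L)
    L-assocˡ : ∀ M N L → RL ((M ⊕ N) ⊕ L) (M ⊕ (N ⊕ L))
    L-comm   : ∀ M N → RL (M ⊕ N) (N ⊕ M)
    L-fact   : ∀ α β M → RL ((α · M) ⊕ (β · M)) ((α + β) · M)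
    L-fact1  : ∀ α M → RL ((α · M) ⊕ M) ((α + 1#) · M)
    L-fact2  : ∀ M → RL (M ⊕ M) ((1# + 1#) · M)
    L-scal   : ∀ α β M → RL (α · (β · M)) ((α * β) · M)
    L-dist   : ∀ α M N → RL (α · (M ⊕ N)) ((α · M) ⊕ (α · N))
    L-one    : ∀ M → RL (1# · M) M
    L-zeroˢ  : ∀ M → RL (0# · M) zer
    L-zeroᵗ  : ∀ α → RL (α · zer) zer
    L-unit   : ∀ M → RL (zer ⊕ M) M

  _∪_ : Rel → Rel → Rel
  (R₁ ∪ R₂) M N = R₁ M N ⊎ R₂ M N

  data Ξ (Rl : Rel) : Rel where
    base : ∀ {M M'} → Rl M M' → Ξ Rl M M'
    appL : ∀ {M M'} N → Ξ Rl M M' → Ξ Rl (M ∙ N) (M' ∙ N)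
    sumL : ∀ {M M'} N → Ξ Rl M M' → Ξ Rl (M ⊕ N) (M' ⊕ N)
    sumR : ∀ {M M'} N → Ξ Rl M M' → Ξ Rl (N ⊕ M) (N ⊕ M')
    scal : ∀ {M M'} α → Ξ Rl M M' → Ξ Rl (α · M) (α · M')

  data Ξlin (Rl : Rel) : Rel where
    base : ∀ {M M'} → Rl M M' → Ξlin Rl M M'
    appL : ∀ {M M'} N → Ξlin Rl M M' → Ξlin Rl (M ∙ N) (M' ∙ N)
    sumL : ∀ {M M'} N → Ξlin Rl M M' → Ξlin Rl (M ⊕ N) (M' ⊕ N)
    sumR : ∀ {M M'} N → Ξlin Rl M M' → Ξlin Rl (N ⊕ M) (N ⊕ M')
    scal : ∀ {M M'} α → Ξlin Rl M M' → Ξlin Rl (α · M) (α · M')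
    appV : ∀ {V M M'} → IsValue V → Ξlin Rl M M' → Ξlin Rl (V ∙ M) (V ∙ M')

  _⟶βn_ _⟶a_ _⟶βv_ _⟶l_ _⟶lβ_ _⟶aβ_ _⟶aβ*_ : Rel
  _⟶βn_ = Ξ Rβn
  _⟶a_  = Ξ (RA ∪ RL)
  _⟶βv_ = Ξlin Rβv
  _⟶l_  = Ξlin ((RAl ∪ RAr) ∪ RL)
  _⟶lβ_ = _⟶l_ ∪ _⟶βv_
  _⟶aβ_ = _⟶a_ ∪ _⟶βn_
  _⟶aβ*_ = Star _⟶aβ_

  -- A context records the kind of each enclosing binder: an ordinary
  -- variable x, the continuation variable k (binder of λk.C), or the
  -- variable b (binder of λb.bSK).  Free variables (indices beyond the
  -- context) are: index 0 = the free continuation variable k, every other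
  -- free index = an ordinary variable.

  data Kind : Set where
    ord kon bv : Kind

  Ctx : Set
  Ctx = List Kind

  -- index i denotes the (innermost, hence the only visible) variable k
  data IsK : Ctx → ℕ → Set where
    top    : IsK [] zero
    here   : ∀ {Γ} → IsK (kon ∷ Γ) zero
    thereO : ∀ {Γ i} → IsK Γ i → IsK (ord ∷ Γ) (suc i)
    thereB : ∀ {Γ i} → IsK Γ i → IsK (bv ∷ Γ) (suc i)

  data IsX : Ctx → ℕ → Set where
    top   : ∀ {i} → IsX [] (suc i)
    here  : ∀ {Γ} → IsX (ord ∷ Γ) zero
    there : ∀ {Γ κ i} → IsX Γ i → IsX (κ ∷ Γ) (suc i)

  mutual
    data IsC (Γ : Ctx) : Term → Set c where
      kb  : ∀ {K B} → IsCont Γ K → IsCVal Γ B → IsC Γ (K ∙ B)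
      bsk : ∀ {B S K} → IsCVal Γ B → IsS Γ S → IsCont Γ K → IsC Γ (B ∙ S ∙ K)
      tk  : ∀ {T K} → IsT Γ T → IsCont Γ K → IsC Γ (T ∙ K)

    data IsD (Γ : Ctx) : Term → Set c where
      comp : ∀ {C} → IsC Γ C → IsD Γ C
      zer  : IsD Γ zer
      scal : ∀ α {D} → IsD Γ D → IsD Γ (α · D)
      plus : ∀ {D₁ D₂} → IsD Γ D₁ → IsD Γ D₂ → IsD Γ (D₁ ⊕ D₂)

    data IsS (Γ : Ctx) : Term → Set c where
      x  : ∀ {i} → IsX Γ i → IsS Γ (var i)
      lk : ∀ {C} → IsC (kon ∷ Γ) C → IsS Γ (lam C)

    data IsT (Γ : Ctx) : Term → Set c where
      susp : ∀ {S} → IsS Γ S → IsT Γ S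
      zer  : IsT Γ zer
      scal : ∀ α {T} → IsT Γ T → IsT Γ (α · T)
      plus : ∀ {T₁ T₂} → IsT Γ T₁ → IsT Γ T₂ → IsT Γ (T₁ ⊕ T₂)

    data IsCont (Γ : Ctx) : Term → Set c where
      k  : ∀ {i} → IsK Γ i → IsCont Γ (var i)
      lb : ∀ {S K} → IsS (bv ∷ Γ) S → IsCont (bv ∷ Γ) K
           → IsCont Γ (lam (var zero ∙ S ∙ K))

    data IsCVal (Γ : Ctx) : Term → Set c where
      lx : ∀ {S} → IsS (ord ∷ Γ) S → IsCVal Γ (lam S)

  -- The k and b binders disappear, so the output
  -- only has ordinary binders; xidx computes the index of an ordinary
  -- variable in the output (free ordinary index suc i becomes free index i).

  xidx : ∀ {Γ i} → IsX Γ i → ℕ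
  xidx (top {i})          = i
  xidx here               = zero
  xidx (there {κ = ord} p) = suc (xidx p)
  xidx (there {κ = kon} p) = xidx p
  xidx (there {κ = bv} p)  = xidx p

  mutual
    barC : ∀ {Γ M} → IsC Γ M → Term
    barC (kb K B)    = plug K (φ B)
    barC (bsk B S K) = plug K (φ B ∙ σ S)
    barC (tk T K)    = plug K (σT T)

    barD : ∀ {Γ M} → IsD Γ M → Term
    barD (comp C)   = barC C
    barD zer        = zer
    barD (scal α D) = α · barD D
    barD (plus D E) = barD D ⊕ barD E

    σ : ∀ {Γ M} → IsS Γ M → Term
    σ (x p)  = var (xidx p)
    σ (lk C) = barC C

    σT : ∀ {Γ M} → IsT Γ M → Term
    σT (susp S)   = σ S
    σT zer        = zer
    σT (scal α T) = α · σT T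
    σT (plus T U) = σT T ⊕ σT U

    φ : ∀ {Γ M} → IsCVal Γ M → Term
    φ (lx S) = lam (σ S)

    plug : ∀ {Γ M} → IsCont Γ M → Term → Term
    plug (k _)    N = N
    plug (lb S K) N = plug K (N ∙ σ S)

module Submission where

-- The proof is a case analysis on the position of the redex, carried
-- out in an arbitrary CPS context Γ (the theorem is the case Γ = []).
--  * The translation only depends on the term, not on its CPS
--    derivation (irrelevance), so the target derivation may be chosen.
--  * Renaming and substitution of CPS-shaped terms stay CPS-shaped and
--    commute with the translation; this handles the three β-redexes:
--    (λb.bSK)B and (λk.C)K translate to the same term as their
--    contractum, while (λx.S)S' K becomes one β step under  K[-].
--  * (A_l) steps on T K are simulated by (A) steps pushing the
--    combination out of the translated continuation  K[-].
--  * (L) steps act on combinations exactly as they do on translations.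
--  * All other redex positions are impossible: CPS variables, values
--    and continuations are normal and are not combinations.

open import Defs
open import Data.List using ([]; _∷_)
open import Algebra.Bundles using (Ring)
open import Data.Nat using (ℕ; zero; suc)
open import Data.Product using (Σ; _,_)
open import Data.Sum using (inj₁; inj₂)
open import Data.Empty using (⊥; ⊥-elim)
open import Relation.Binary.PropositionalEquality
  using (_≡_; refl; sym; trans; cong; cong₂; module ≡-Reasoning)
open import Relation.Binary.Construct.Closure.ReflexiveTransitive using (ε; _◅_; gmap)

module Simulation {c ℓ} (R : Ring c ℓ) where
  open Lambda R
  open Ring R using () renaming (_+_ to _+ᴿ_; _*_ to _*ᴿ_; 1# to 1ᴿ)
  open ≡-Reasoning

  ren-cong : ∀ {ρ ρ' : ℕ → ℕ} → (∀ i → ρ i ≡ ρ' i) → ∀ M → rename ρ M ≡ rename ρ' M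
  ren-cong e (var i) = cong var (e i)
  ren-cong e (lam M) = cong lam (ren-cong e' M)
    where
      e' : ∀ i → ext _ i ≡ ext _ i
      e' zero    = refl
      e' (suc i) = cong suc (e i)
  ren-cong e (M ∙ N) = cong₂ _∙_ (ren-cong e M) (ren-cong e N)
  ren-cong e zer     = refl
  ren-cong e (α · M) = cong (α ·_) (ren-cong e M)
  ren-cong e (M ⊕ N) = cong₂ _⊕_ (ren-cong e M) (ren-cong e N)

  ren-id : ∀ M → rename (λ i → i) M ≡ M
  ren-id (var i) = refl
  ren-id (lam M) = cong lam (trans (ren-cong ext-id M) (ren-id M))
    where
      ext-id : ∀ i → ext (λ j → j) i ≡ i
      ext-id zero    = refl
      ext-id (suc i) = refl
  ren-id (M ∙ N) = cong₂ _∙_ (ren-id M) (ren-id N)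
  ren-id zer     = refl
  ren-id (α · M) = cong (α ·_) (ren-id M)
  ren-id (M ⊕ N) = cong₂ _⊕_ (ren-id M) (ren-id N)

  sub-cong : ∀ {τ τ' : ℕ → Term} → (∀ i → τ i ≡ τ' i) → ∀ M → subst τ M ≡ subst τ' M
  sub-cong e (var i) = e i
  sub-cong e (lam M) = cong lam (sub-cong e' M)
    where
      e' : ∀ i → exts _ i ≡ exts _ i
      e' zero    = refl
      e' (suc i) = cong (rename suc) (e i)
  sub-cong e (M ∙ N) = cong₂ _∙_ (sub-cong e M) (sub-cong e N)
  sub-cong e zer     = refl
  sub-cong e (α · M) = cong (α ·_) (sub-cong e M)
  sub-cong e (M ⊕ N) = cong₂ _⊕_ (sub-cong e M) (sub-cong e N)

  sub-id : ∀ M → subst var M ≡ M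
  sub-id (var i) = refl
  sub-id (lam M) = cong lam (trans (sub-cong exts-id M) (sub-id M))
    where
      exts-id : ∀ i → exts var i ≡ var i
      exts-id zero    = refl
      exts-id (suc i) = refl
  sub-id (M ∙ N) = cong₂ _∙_ (sub-id M) (sub-id N)
  sub-id zer     = refl
  sub-id (α · M) = cong (α ·_) (sub-id M)
  sub-id (M ⊕ N) = cong₂ _⊕_ (sub-id M) (sub-id N)

  -- The only overlaps between
  -- the grammar classes are ruled out by the next two facts.

  K-not-X : ∀ {Γ i} → IsK Γ i → IsX Γ i → ⊥
  K-not-X top ()
  K-not-X here ()
  K-not-X (thereO p) (there q) = K-not-X p q
  K-not-X (thereB p) (there q) = K-not-X p q

  C-not-var-headed : ∀ {Γ i S K} → IsC Γ (var i ∙ S ∙ K) → ⊥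
  C-not-var-headed (kb () _)
  C-not-var-headed (bsk () _ _)
  C-not-var-headed (tk (susp ()) _)

  X-unique : ∀ {Γ i} (p q : IsX Γ i) → p ≡ q
  X-unique top top = refl
  X-unique here here = refl
  X-unique (there p) (there q) = cong there (X-unique p q)

  mutual
    irrC : ∀ {Γ M} (a b : IsC Γ M) → barC a ≡ barC b
    irrC (kb k₁ b₁) (kb k₂ b₂) = trans (irrK k₁ k₂ _) (cong (plug k₂) (irrV b₁ b₂))
    irrC (bsk b₁ s₁ k₁) (bsk b₂ s₂ k₂) =
      trans (irrK k₁ k₂ _) (cong (plug k₂) (cong₂ _∙_ (irrV b₁ b₂) (irrS s₁ s₂)))
    irrC (tk t₁ k₁) (tk t₂ k₂) = trans (irrK k₁ k₂ _) (cong (plug k₂) (irrT t₁ t₂))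
    irrC (kb () _) (bsk _ _ _)
    irrC (bsk _ _ _) (kb () _)
    irrC (bsk _ _ _) (tk (susp ()) _)
    irrC (tk (susp ()) _) (bsk _ _ _)
    irrC (kb (k p) _) (tk (susp (x q)) _) = ⊥-elim (K-not-X p q)
    irrC (tk (susp (x q)) _) (kb (k p) _) = ⊥-elim (K-not-X p q)
    irrC (kb (lb _ _) _) (tk (susp (lk c)) _) = ⊥-elim (C-not-var-headed c)
    irrC (tk (susp (lk c)) _) (kb (lb _ _) _) = ⊥-elim (C-not-var-headed c)

    irrS : ∀ {Γ M} (a b : IsS Γ M) → σ a ≡ σ b
    irrS (x p) (x q)   = cong (λ r → var (xidx r)) (X-unique p q)
    irrS (lk a) (lk b) = irrC a b

    irrT : ∀ {Γ M} (a b : IsT Γ M) → σT a ≡ σT b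
    irrT (susp a) (susp b) = irrS a b
    irrT zer zer = refl
    irrT (scal α a) (scal .α b) = cong (α ·_) (irrT a b)
    irrT (plus a a') (plus b b') = cong₂ _⊕_ (irrT a b) (irrT a' b')
    irrT (susp ()) zer
    irrT (susp ()) (scal _ _)
    irrT (susp ()) (plus _ _)
    irrT zer (susp ())
    irrT (scal _ _) (susp ())
    irrT (plus _ _) (susp ())

    irrK : ∀ {Γ M} (a b : IsCont Γ M) N → plug a N ≡ plug b N
    irrK (k _) (k _) N = refl
    irrK (lb s₁ k₁) (lb s₂ k₂) N =
      trans (cong (λ S → plug k₁ (N ∙ S)) (irrS s₁ s₂)) (irrK k₁ k₂ _)

    irrV : ∀ {Γ M} (a b : IsCVal Γ M) → φ a ≡ φ b
    irrV (lx a) (lx b) = cong lam (irrS a b)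

  irrD : ∀ {Γ M} (a b : IsD Γ M) → barD a ≡ barD b
  irrD (comp a) (comp b) = irrC a b
  irrD zer zer = refl
  irrD (scal α a) (scal .α b) = cong (α ·_) (irrD a b)
  irrD (plus a a') (plus b b') = cong₂ _⊕_ (irrD a b) (irrD a' b')
  irrD (comp ()) zer
  irrD (comp ()) (scal _ _)
  irrD (comp ()) (plus _ _)
  irrD zer (comp ())
  irrD (scal _ _) (comp ())
  irrD (plus _ _) (comp ())

  -- A binder of kind κ survives the translation only when κ = ord:
  -- this is how a renaming or substitution of translated terms is lifted.
  liftᵗ : Kind → (ℕ → ℕ) → ℕ → ℕ
  liftᵗ ord ρ̂ = ext ρ̂
  liftᵗ kon ρ̂ = ρ̂
  liftᵗ bv  ρ̂ = ρ̂

  RenX : Ctx → Ctx → (ℕ → ℕ) → (ℕ → ℕ) → Set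
  RenX Γ Δ ρ ρ̂ = ∀ {i} (p : IsX Γ i) → Σ (IsX Δ (ρ i)) λ q → xidx q ≡ ρ̂ (xidx p)

  RenK : Ctx → Ctx → (ℕ → ℕ) → Set
  RenK Γ Δ ρ = ∀ {i} → IsK Γ i → IsK Δ (ρ i)

  liftRenX : ∀ {Γ Δ ρ ρ̂} κ → RenX Γ Δ ρ ρ̂ → RenX (κ ∷ Γ) (κ ∷ Δ) (ext ρ) (liftᵗ κ ρ̂)
  liftRenX ord rx here = here , refl
  liftRenX ord rx (there p) = let (q , e) = rx p in there q , cong suc e
  liftRenX kon rx (there p) = let (q , e) = rx p in there q , e
  liftRenX bv  rx (there p) = let (q , e) = rx p in there q , e

  -- the bound k of λk.C is the only visible continuation variable in C
  bound-k-RenK : ∀ {Γ Δ ρ} → RenK (kon ∷ Γ) (kon ∷ Δ) (ext ρ)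
  bound-k-RenK here = here

  liftRenK : ∀ {Γ Δ ρ} κ → RenK Γ Δ ρ → RenK (κ ∷ Γ) (κ ∷ Δ) (ext ρ)
  liftRenK ord rk (thereO p) = thereO (rk p)
  liftRenK kon rk = bound-k-RenK
  liftRenK bv  rk (thereB p) = thereB (rk p)

  mutual
    renS : ∀ {Γ Δ ρ ρ̂ M} → RenX Γ Δ ρ ρ̂ → (s : IsS Γ M) →
           Σ (IsS Δ (rename ρ M)) λ s' → σ s' ≡ rename ρ̂ (σ s)
    renS rx (x p) = let (q , e) = rx p in x q , cong var e
    renS {ρ = ρ} {ρ̂} rx (lk c) =
      let (c' , e) = renC (liftRenX {ρ = ρ} {ρ̂} kon rx) bound-k-RenK c in lk c' , e

    renC : ∀ {Γ Δ ρ ρ̂ M} → RenX Γ Δ ρ ρ̂ → RenK Γ Δ ρ → (c : IsC Γ M) →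
           Σ (IsC Δ (rename ρ M)) λ c' → barC c' ≡ rename ρ̂ (barC c)
    renC rx rk (kb kk b) =
      let (k' , eK) = renK rx rk kk ; (b' , eB) = renV rx b in
      kb k' b' , trans (cong (plug k') eB) (eK (φ b))
    renC rx rk (bsk b s kk) =
      let (k' , eK) = renK rx rk kk ; (b' , eB) = renV rx b ; (s' , eS) = renS rx s in
      bsk b' s' k' , trans (cong (plug k') (cong₂ _∙_ eB eS)) (eK (φ b ∙ σ s))
    renC rx rk (tk t kk) =
      let (k' , eK) = renK rx rk kk ; (t' , eT) = renT rx t in
      tk t' k' , trans (cong (plug k') eT) (eK (σT t))

    renT : ∀ {Γ Δ ρ ρ̂ M} → RenX Γ Δ ρ ρ̂ → (t : IsT Γ M) →
           Σ (IsT Δ (rename ρ M)) λ t' → σT t' ≡ rename ρ̂ (σT t)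
    renT rx (susp s) = let (s' , e) = renS rx s in susp s' , e
    renT rx zer = zer , refl
    renT rx (scal α t) = let (t' , e) = renT rx t in scal α t' , cong (α ·_) e
    renT rx (plus t u) =
      let (t' , e) = renT rx t ; (u' , e') = renT rx u in plus t' u' , cong₂ _⊕_ e e'

    renV : ∀ {Γ Δ ρ ρ̂ M} → RenX Γ Δ ρ ρ̂ → (b : IsCVal Γ M) →
           Σ (IsCVal Δ (rename ρ M)) λ b' → φ b' ≡ rename ρ̂ (φ b)
    renV rx (lx s) = let (s' , e) = renS (liftRenX ord rx) s in lx s' , cong lam e

    renK : ∀ {Γ Δ ρ ρ̂ M} → RenX Γ Δ ρ ρ̂ → RenK Γ Δ ρ → (kk : IsCont Γ M) →
           Σ (IsCont Δ (rename ρ M)) λ k' → ∀ N → plug k' (rename ρ̂ N) ≡ rename ρ̂ (plug kk N)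
    renK rx rk (k p) = k (rk p) , λ N → refl
    renK {ρ = ρ} {ρ̂} rx rk (lb s kk) =
      let rx' = liftRenX {ρ = ρ} {ρ̂} bv rx
          (s' , eS) = renS rx' s ; (k' , eK) = renK rx' (liftRenK bv rk) kk in
      lb s' k' , λ N → trans (cong (λ S → plug k' (rename ρ̂ N ∙ S)) eS) (eK (N ∙ σ s))

  wkᵗ : Kind → ℕ → ℕ
  wkᵗ ord = suc
  wkᵗ kon = λ i → i
  wkᵗ bv  = λ i → i

  wkRenX : ∀ {Δ} κ → RenX Δ (κ ∷ Δ) suc (wkᵗ κ)
  wkRenX ord p = there p , refl
  wkRenX kon p = there p , refl
  wkRenX bv  p = there p , refl

  SubX : Ctx → Ctx → (ℕ → Term) → (ℕ → Term) → Set c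
  SubX Γ Δ τ τ̂ = ∀ {i} (p : IsX Γ i) → Σ (IsS Δ (τ i)) λ s → σ s ≡ τ̂ (xidx p)

  SubK : Ctx → Ctx → (ℕ → Term) → (Term → Term) → Set c
  SubK Γ Δ τ P = ∀ {i} → IsK Γ i → Σ (IsCont Δ (τ i)) λ kk → ∀ N → plug kk N ≡ P N

  liftˢ : Kind → (ℕ → Term) → ℕ → Term
  liftˢ ord τ̂ = exts τ̂
  liftˢ kon τ̂ = τ̂
  liftˢ bv  τ̂ = τ̂

  liftSubX : ∀ {Γ Δ τ τ̂} κ → SubX Γ Δ τ τ̂ → SubX (κ ∷ Γ) (κ ∷ Δ) (exts τ) (liftˢ κ τ̂)
  liftSubX ord sx here = x here , refl
  liftSubX ord sx (there p) =
    let (s , e) = sx p ; (s' , e') = renS (wkRenX ord) s in s' , trans e' (cong (rename suc) e)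
  liftSubX kon sx (there p) =
    let (s , e) = sx p ; (s' , e') = renS (wkRenX kon) s in s' , trans e' (trans (ren-id _) e)
  liftSubX bv sx (there p) =
    let (s , e) = sx p ; (s' , e') = renS (wkRenX bv) s in s' , trans e' (trans (ren-id _) e)

  bound-k-SubK : ∀ {Γ Δ τ} → SubK (kon ∷ Γ) (kon ∷ Δ) (exts τ) (λ N → N)
  bound-k-SubK here = k here , λ N → refl

  -- under λb, continuation variables are weakened past b, invisibly to plugging
  liftSubK-bv : ∀ {Γ Δ τ P} → SubK Γ Δ τ P → SubK (bv ∷ Γ) (bv ∷ Δ) (exts τ) P
  liftSubK-bv sk (thereB p) =
    let (kk , e) = sk p ; (k' , e') = renK (wkRenX bv) thereB kk in
    k' , λ N → begin
      plug k' N                          ≡⟨ cong (plug k') (sym (ren-id N)) ⟩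
      plug k' (rename (λ i → i) N)       ≡⟨ e' N ⟩
      rename (λ i → i) (plug kk N)       ≡⟨ ren-id _ ⟩
      plug kk N                          ≡⟨ e N ⟩
      _                                  ∎

  -- Substitution preserves the CPS classes and commutes with the translation;
  -- a continuation substituted for k is translated as its plugging P.
  mutual
    subS : ∀ {Γ Δ τ τ̂ M} → SubX Γ Δ τ τ̂ → (s : IsS Γ M) →
           Σ (IsS Δ (subst τ M)) λ s' → σ s' ≡ subst τ̂ (σ s)
    subS sx (x p) = sx p
    subS {τ = τ} {τ̂} sx (lk c) =
      let (c' , e) = subC (liftSubX {τ = τ} {τ̂} kon sx) bound-k-SubK c in lk c' , e

    subC : ∀ {Γ Δ τ τ̂ P M} → SubX Γ Δ τ τ̂ → SubK Γ Δ τ P → (c : IsC Γ M) →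
           Σ (IsC Δ (subst τ M)) λ c' → barC c' ≡ P (subst τ̂ (barC c))
    subC sx sk (kb kk b) =
      let (k' , eK) = subK sx sk kk ; (b' , eB) = subV sx b in
      kb k' b' , trans (cong (plug k') eB) (eK (φ b))
    subC sx sk (bsk b s kk) =
      let (k' , eK) = subK sx sk kk ; (b' , eB) = subV sx b ; (s' , eS) = subS sx s in
      bsk b' s' k' , trans (cong (plug k') (cong₂ _∙_ eB eS)) (eK (φ b ∙ σ s))
    subC sx sk (tk t kk) =
      let (k' , eK) = subK sx sk kk ; (t' , eT) = subT sx t in
      tk t' k' , trans (cong (plug k') eT) (eK (σT t))

    subT : ∀ {Γ Δ τ τ̂ M} → SubX Γ Δ τ τ̂ → (t : IsT Γ M) →
           Σ (IsT Δ (subst τ M)) λ t' → σT t' ≡ subst τ̂ (σT t)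
    subT sx (susp s) = let (s' , e) = subS sx s in susp s' , e
    subT sx zer = zer , refl
    subT sx (scal α t) = let (t' , e) = subT sx t in scal α t' , cong (α ·_) e
    subT sx (plus t u) =
      let (t' , e) = subT sx t ; (u' , e') = subT sx u in plus t' u' , cong₂ _⊕_ e e'

    subV : ∀ {Γ Δ τ τ̂ M} → SubX Γ Δ τ τ̂ → (b : IsCVal Γ M) →
           Σ (IsCVal Δ (subst τ M)) λ b' → φ b' ≡ subst τ̂ (φ b)
    subV sx (lx s) = let (s' , e) = subS (liftSubX ord sx) s in lx s' , cong lam e

    subK : ∀ {Γ Δ τ τ̂ P M} → SubX Γ Δ τ τ̂ → SubK Γ Δ τ P → (kk : IsCont Γ M) →
           Σ (IsCont Δ (subst τ M)) λ k' → ∀ N → plug k' (subst τ̂ N) ≡ P (subst τ̂ (plug kk N))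
    subK sx sk (k p) = let (k' , e) = sk p in k' , λ N → e _
    subK {τ = τ} {τ̂} sx sk (lb s kk) =
      let sx' = liftSubX {τ = τ} {τ̂} bv sx
          (s' , eS) = subS sx' s ; (k' , eK) = subK sx' (liftSubK-bv sk) kk in
      lb s' k' , λ N → trans (cong (λ S → plug k' (subst τ̂ N ∙ S)) eS) (eK (N ∙ σ s))

  -- The source relation  ⟶l ∪ ⟶βv  embeds into one closure, which lets
  -- every case analysis below treat both kinds of step uniformly.
  Step : Rel
  Step = Ξlin (((RAl ∪ RAr) ∪ RL) ∪ Rβv)

  pattern stepAl r = base (inj₁ (inj₁ (inj₁ r)))
  pattern stepAr r = base (inj₁ (inj₁ (inj₂ r)))
  pattern stepL  r = base (inj₁ (inj₂ r))
  pattern stepβ  r = base (inj₂ r)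

  Ξlin-mono : ∀ {R₁ R₂ : Rel} → (∀ {M N} → R₁ M N → R₂ M N) →
              ∀ {M N} → Ξlin R₁ M N → Ξlin R₂ M N
  Ξlin-mono f (base r)   = base (f r)
  Ξlin-mono f (appL N s) = appL N (Ξlin-mono f s)
  Ξlin-mono f (sumL N s) = sumL N (Ξlin-mono f s)
  Ξlin-mono f (sumR N s) = sumR N (Ξlin-mono f s)
  Ξlin-mono f (scal α s) = scal α (Ξlin-mono f s)
  Ξlin-mono f (appV v s) = appV v (Ξlin-mono f s)

  toStep : ∀ {M N} → M ⟶lβ N → Step M N
  toStep (inj₁ s) = Ξlin-mono inj₁ s
  toStep (inj₂ s) = Ξlin-mono inj₂ s

  -- Variables, abstractions and 0 are Step-normal (no reduction under λ).
  var-normal : ∀ {i M} → Step (var i) M → ⊥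
  var-normal (stepAl ())
  var-normal (stepAr ())
  var-normal (stepL ())
  var-normal (stepβ ())

  lam-normal : ∀ {L M} → Step (lam L) M → ⊥
  lam-normal (stepAl ())
  lam-normal (stepAr ())
  lam-normal (stepL ())
  lam-normal (stepβ ())

  zer-normal : ∀ {M} → Step zer M → ⊥
  zer-normal (stepAl ())
  zer-normal (stepAr ())
  zer-normal (stepL ())
  zer-normal (stepβ ())

  cont-normal : ∀ {Γ K M} → IsCont Γ K → Step K M → ⊥
  cont-normal (k _)    = var-normal
  cont-normal (lb _ _) = lam-normal

  cval-normal : ∀ {Γ B M} → IsCVal Γ B → Step B M → ⊥
  cval-normal (lx _) = lam-normal

  susp-normal : ∀ {Γ S M} → IsS Γ S → Step S M → ⊥
  susp-normal (x _)  = var-normal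
  susp-normal (lk _) = lam-normal

  -- Terms of the shape 0, α.M or M + N: the positions (A_l) and (A_r)
  -- inspect.  No continuation, CPS-value or base suspension has this shape.
  data IsComb : Term → Set c where
    zer  : IsComb zer
    scal : ∀ α M → IsComb (α · M)
    plus : ∀ M N → IsComb (M ⊕ N)

  Al-fun : ∀ {M N M'} → RAl (M ∙ N) M' → IsComb M
  Al-fun (Al-plus M N _) = plus M N
  Al-fun (Al-scal α M _) = scal α M
  Al-fun (Al-zer _)      = zer

  Ar-arg : ∀ {M N M'} → RAr (M ∙ N) M' → IsComb N
  Ar-arg (Ar-plus _ M N) = plus M N
  Ar-arg (Ar-scal _ α M) = scal α M
  Ar-arg (Ar-zer _)      = zer

  Ar-fun : ∀ {M N M'} → RAr (M ∙ N) M' → IsBase M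
  Ar-fun (Ar-plus b _ _) = b
  Ar-fun (Ar-scal b _ _) = b
  Ar-fun (Ar-zer b)      = b

  cont-not-comb : ∀ {Γ K} → IsCont Γ K → IsComb K → ⊥
  cont-not-comb (k _) ()
  cont-not-comb (lb _ _) ()

  cval-not-comb : ∀ {Γ B} → IsCVal Γ B → IsComb B → ⊥
  cval-not-comb (lx _) ()

  susp-not-comb : ∀ {Γ S} → IsS Γ S → IsComb S → ⊥
  susp-not-comb (x _) ()
  susp-not-comb (lk _) ()

  under : (f : Term → Term) → (∀ {Rl M M'} → Ξ Rl M M' → Ξ Rl (f M) (f M')) →
          ∀ {M M'} → M ⟶aβ M' → f M ⟶aβ f M'
  under f g (inj₁ s) = inj₁ (g s)
  under f g (inj₂ s) = inj₂ (g s)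

  under* : (f : Term → Term) → (∀ {Rl M M'} → Ξ Rl M M' → Ξ Rl (f M) (f M')) →
           ∀ {M M'} → M ⟶aβ* M' → f M ⟶aβ* f M'
  under* f g = gmap f (under f g)

  _≡⟶_ : ∀ {M N L} → M ⟶aβ* N → N ≡ L → M ⟶aβ* L
  s ≡⟶ refl = s

  infixl 4 _≡⟶_

  plug-step : ∀ {Γ K M M'} (kk : IsCont Γ K) → M ⟶aβ M' → plug kk M ⟶aβ plug kk M'
  plug-step (k _)     s = s
  plug-step (lb S kk) s = plug-step kk (under (_∙ σ S) (appL (σ S)) s)

  A-step : ∀ {M M'} → RA M M' → M ⟶aβ M'
  A-step r = inj₁ (base (inj₁ r))

  plug-plus : ∀ {Γ K} (kk : IsCont Γ K) M N → plug kk (M ⊕ N) ⟶aβ* (plug kk M ⊕ plug kk N)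
  plug-plus (k _)     M N = ε
  plug-plus (lb S kk) M N = plug-step kk (A-step (A-plus M N (σ S))) ◅ plug-plus kk _ _

  plug-scal : ∀ {Γ K} (kk : IsCont Γ K) α M → plug kk (α · M) ⟶aβ* (α · plug kk M)
  plug-scal (k _)     α M = ε
  plug-scal (lb S kk) α M = plug-step kk (A-step (A-scal α M (σ S))) ◅ plug-scal kk _ _

  plug-zer : ∀ {Γ K} (kk : IsCont Γ K) → plug kk zer ⟶aβ* zer
  plug-zer (k _)     = ε
  plug-zer (lb S kk) = plug-step kk (A-step (A-zer (σ S))) ◅ plug-zer kk

  -- The factorisation rules
  -- need irrelevance: the two copies of M may carry different derivations.
  L-step : ∀ {M M'} → RL M M' → Ξ (RA ∪ RL) M M'
  L-step r = base (inj₂ r)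

  L-step≡ : ∀ {M M' N N'} → M ≡ N → RL M M' → M' ≡ N' → Ξ (RA ∪ RL) N N'
  L-step≡ refl r refl = L-step r

  combT-L : ∀ {Γ M M'} (t : IsT Γ M) → RL M M' → Σ (IsT Γ M') λ t' → Ξ (RA ∪ RL) (σT t) (σT t')
  combT-L (plus t₁ (plus t₂ t₃)) (L-assocʳ _ _ _) = plus (plus t₁ t₂) t₃ , L-step (L-assocʳ _ _ _)
  combT-L (plus (plus t₁ t₂) t₃) (L-assocˡ _ _ _) = plus t₁ (plus t₂ t₃) , L-step (L-assocˡ _ _ _)
  combT-L (plus t₁ t₂) (L-comm _ _) = plus t₂ t₁ , L-step (L-comm _ _)
  combT-L (plus (scal α t₁) (scal β t₂)) (L-fact .α .β _) =
    scal (α +ᴿ β) t₁ , L-step≡ (cong (λ T → α · σT t₁ ⊕ β · T) (irrT t₁ t₂)) (L-fact α β _) refl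
  combT-L (plus (scal α t₁) t₂) (L-fact1 .α _) =
    scal (α +ᴿ 1ᴿ) t₁ , L-step≡ (cong (λ T → α · σT t₁ ⊕ T) (irrT t₁ t₂)) (L-fact1 α _) refl
  combT-L (plus t₁ t₂) (L-fact2 _) =
    scal (1ᴿ +ᴿ 1ᴿ) t₁ , L-step≡ (cong (σT t₁ ⊕_) (irrT t₁ t₂)) (L-fact2 _) refl
  combT-L (scal α (scal β t)) (L-scal .α .β _) = scal (α *ᴿ β) t , L-step (L-scal _ _ _)
  combT-L (scal α (plus t₁ t₂)) (L-dist .α _ _) = plus (scal α t₁) (scal α t₂) , L-step (L-dist _ _ _)
  combT-L (scal _ t) (L-one _) = t , L-step (L-one _)
  combT-L (scal _ t) (L-zeroˢ _) = zer , L-step (L-zeroˢ _)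
  combT-L (scal α zer) (L-zeroᵗ .α) = zer , L-step (L-zeroᵗ _)
  combT-L (plus zer t) (L-unit _) = t , L-step (L-unit _)

  combD-L : ∀ {Γ M M'} (d : IsD Γ M) → RL M M' → Σ (IsD Γ M') λ d' → Ξ (RA ∪ RL) (barD d) (barD d')
  combD-L (plus d₁ (plus d₂ d₃)) (L-assocʳ _ _ _) = plus (plus d₁ d₂) d₃ , L-step (L-assocʳ _ _ _)
  combD-L (plus (plus d₁ d₂) d₃) (L-assocˡ _ _ _) = plus d₁ (plus d₂ d₃) , L-step (L-assocˡ _ _ _)
  combD-L (plus d₁ d₂) (L-comm _ _) = plus d₂ d₁ , L-step (L-comm _ _)
  combD-L (plus (scal α d₁) (scal β d₂)) (L-fact .α .β _) =
    scal (α +ᴿ β) d₁ , L-step≡ (cong (λ D → α · barD d₁ ⊕ β · D) (irrD d₁ d₂)) (L-fact α β _) refl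
  combD-L (plus (scal α d₁) d₂) (L-fact1 .α _) =
    scal (α +ᴿ 1ᴿ) d₁ , L-step≡ (cong (λ D → α · barD d₁ ⊕ D) (irrD d₁ d₂)) (L-fact1 α _) refl
  combD-L (plus d₁ d₂) (L-fact2 _) =
    scal (1ᴿ +ᴿ 1ᴿ) d₁ , L-step≡ (cong (barD d₁ ⊕_) (irrD d₁ d₂)) (L-fact2 _) refl
  combD-L (scal α (scal β d)) (L-scal .α .β _) = scal (α *ᴿ β) d , L-step (L-scal _ _ _)
  combD-L (scal α (plus d₁ d₂)) (L-dist .α _ _) = plus (scal α d₁) (scal α d₂) , L-step (L-dist _ _ _)
  combD-L (scal _ d) (L-one _) = d , L-step (L-one _)
  combD-L (scal _ d) (L-zeroˢ _) = zer , L-step (L-zeroˢ _)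
  combD-L (scal α zer) (L-zeroᵗ .α) = zer , L-step (L-zeroᵗ _)
  combD-L (plus zer d) (L-unit _) = d , L-step (L-unit _)

  -- A step inside a suspension combination is an (L) step on some
  -- sub-combination, and is simulated by exactly one target step.
  simT : ∀ {Γ M M'} (t : IsT Γ M) → Step M M' → Σ (IsT Γ M') λ t' → σT t ⟶aβ σT t'
  simT t (stepL r) = let (t' , s) = combT-L t r in t' , inj₁ s
  simT (susp S) st = ⊥-elim (susp-normal S st)
  simT zer st = ⊥-elim (zer-normal st)
  simT (scal _ _) (stepAl ())
  simT (scal _ _) (stepAr ())
  simT (plus _ _) (stepAl ())
  simT (plus _ _) (stepAr ())
  simT (plus t₁ t₂) (sumL _ st) = let (t₁' , s) = simT t₁ st in plus t₁' t₂ , under _ (sumL _) s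
  simT (plus t₁ t₂) (sumR _ st) = let (t₂' , s) = simT t₂ st in plus t₁ t₂' , under _ (sumR _) s
  simT (scal α t) (scal _ st) = let (t' , s) = simT t st in scal α t' , under _ (scal α) s

  -- (λb.b S K) B  ⟶βv  B S K :  b does not occur in S, K, so the
  -- contractum translates to the same term  K[(λx.S₀) S].
  sim-KB-β : ∀ {Γ S K S₀} (s : IsS (bv ∷ Γ) S) (kk : IsCont (bv ∷ Γ) K) (s₀ : IsS (ord ∷ Γ) S₀)
             (d' : IsD Γ ((var zero ∙ S ∙ K) [ lam S₀ ])) → barC (kb (lb s kk) (lx s₀)) ≡ barD d'
  sim-KB-β {Γ} {S₀ = S₀} s kk s₀ d' =
    let (s' , eS) = subS drop-bX s ; (k' , eK) = subK drop-bX drop-bK kk in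
    begin
      plug kk (lam (σ s₀) ∙ σ s)                     ≡⟨ sym (sub-id _) ⟩
      subst var (plug kk (lam (σ s₀) ∙ σ s))         ≡⟨ sym (eK _) ⟩
      plug k' (subst var (lam (σ s₀) ∙ σ s))         ≡⟨ cong (λ M → plug k' (M ∙ subst var (σ s))) (sub-id _) ⟩
      plug k' (lam (σ s₀) ∙ subst var (σ s))         ≡⟨ cong (λ S → plug k' (lam (σ s₀) ∙ S)) (sym eS) ⟩
      barC (bsk (lx s₀) s' k')                       ≡⟨ irrD (comp (bsk (lx s₀) s' k')) d' ⟩
      barD d'                                        ∎
    where
      drop-bX : SubX (bv ∷ Γ) Γ (σ₀ (lam S₀)) var
      drop-bX (there p) = x p , refl
      drop-bK : SubK (bv ∷ Γ) Γ (σ₀ (lam S₀)) (λ N → N)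
      drop-bK (thereB p) = k p , λ N → refl

  -- (λx.S₀) S K  ⟶βv  S₀[x:=S] K  is one βn step under  K[-].
  sim-BSK-β : ∀ {Γ S₀ S K} (s₀ : IsS (ord ∷ Γ) S₀) (s : IsS Γ S) (kk : IsCont Γ K)
              (d' : IsD Γ (S₀ [ S ] ∙ K)) → barC (bsk (lx s₀) s kk) ⟶aβ* barD d'
  sim-BSK-β {Γ} {S = S} s₀ s kk d' =
    let (s' , e) = subS substX s₀ in
    plug-step kk (inj₂ (base (βn (σ s₀) (σ s)))) ◅ ε
      ≡⟶ trans (cong (plug kk) (sym e)) (irrD (comp (tk (susp s') kk)) d')
    where
      substX : SubX (ord ∷ Γ) Γ (σ₀ S) (σ₀ (σ s))
      substX here      = s , refl
      substX (there p) = x p , refl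

  -- (λk.C) K  ⟶βv  C[k:=K] :  substituting K for k is plugging into K[-],
  -- which is exactly how  \overline{(λk.C) K} = K[\overline{C}]  is formed.
  sim-TK-β : ∀ {Γ C K} (c₀ : IsC (kon ∷ Γ) C) (kk : IsCont Γ K)
             (d' : IsD Γ (C [ K ])) → barC (tk (susp (lk c₀)) kk) ≡ barD d'
  sim-TK-β {Γ} {K = K} c₀ kk d' =
    let (c' , e) = subC substX substK c₀ in
    begin
      plug kk (barC c₀)               ≡⟨ cong (plug kk) (sym (sub-id _)) ⟩
      plug kk (subst var (barC c₀))   ≡⟨ sym e ⟩
      barC c'                         ≡⟨ irrD (comp c') d' ⟩
      barD d'                         ∎
    where
      substX : SubX (kon ∷ Γ) Γ (σ₀ K) var
      substX (there p) = x p , refl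
      substK : SubK (kon ∷ Γ) Γ (σ₀ K) (plug kk)
      substK here = kk , λ N → refl

  simKB : ∀ {Γ K B M'} (kk : IsCont Γ K) (b : IsCVal Γ B) (d' : IsD Γ M') →
          Step (K ∙ B) M' → barC (kb kk b) ⟶aβ* barD d'
  simKB kk b d' (stepAl r) = ⊥-elim (cont-not-comb kk (Al-fun r))
  simKB kk b d' (stepAr r) = ⊥-elim (cval-not-comb b (Ar-arg r))
  simKB (lb s kk) (lx s₀) d' (stepβ (βv _ _)) = ε ≡⟶ sim-KB-β s kk s₀ d'
  simKB kk b d' (appL _ st) = ⊥-elim (cont-normal kk st)
  simKB kk b d' (appV _ st) = ⊥-elim (cval-normal b st)

  simBSK : ∀ {Γ B S K M'} (b : IsCVal Γ B) (s : IsS Γ S) (kk : IsCont Γ K) (d' : IsD Γ M') →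
           Step (B ∙ S ∙ K) M' → barC (bsk b s kk) ⟶aβ* barD d'
  simBSK b s kk d' (stepAr r) with Ar-fun r
  ... | ()
  simBSK b s kk d' (appL _ (stepAl r)) = ⊥-elim (cval-not-comb b (Al-fun r))
  simBSK b s kk d' (appL _ (stepAr r)) = ⊥-elim (susp-not-comb s (Ar-arg r))
  simBSK (lx s₀) s kk d' (appL _ (stepβ (βv _ _))) = sim-BSK-β s₀ s kk d'
  simBSK b s kk d' (appL _ (appL _ st)) = ⊥-elim (cval-normal b st)
  simBSK b s kk d' (appL _ (appV _ st)) = ⊥-elim (susp-normal s st)
  simBSK b s kk d' (appV (base ()) st)

  simTK : ∀ {Γ T K M'} (t : IsT Γ T) (kk : IsCont Γ K) (d' : IsD Γ M') →
          Step (T ∙ K) M' → barC (tk t kk) ⟶aβ* barD d'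
  simTK (plus t₁ t₂) kk d' (stepAl (Al-plus _ _ _)) =
    plug-plus kk _ _ ≡⟶ irrD (plus (comp (tk t₁ kk)) (comp (tk t₂ kk))) d'
  simTK (scal α t) kk d' (stepAl (Al-scal _ _ _)) =
    plug-scal kk _ _ ≡⟶ irrD (scal α (comp (tk t kk))) d'
  simTK zer kk d' (stepAl (Al-zer _)) = plug-zer kk ≡⟶ irrD zer d'
  simTK (susp s) kk d' (stepAl r) = ⊥-elim (susp-not-comb s (Al-fun r))
  simTK t kk d' (stepAr r) = ⊥-elim (cont-not-comb kk (Ar-arg r))
  simTK (susp (lk c₀)) kk d' (stepβ (βv _ _)) = ε ≡⟶ sim-TK-β c₀ kk d'
  simTK t kk d' (appL _ st) =
    let (t' , s) = simT t st in plug-step kk s ◅ ε ≡⟶ irrD (comp (tk t' kk)) d'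
  simTK t kk d' (appV _ st) = ⊥-elim (cont-normal kk st)

  simC : ∀ {Γ M M'} (c : IsC Γ M) (d' : IsD Γ M') → Step M M' → barC c ⟶aβ* barD d'
  simC (kb kk b)    = simKB kk b
  simC (bsk b s kk) = simBSK b s kk
  simC (tk t kk)    = simTK t kk

  simD : ∀ {Γ M M'} (d : IsD Γ M) (d' : IsD Γ M') → Step M M' → barD d ⟶aβ* barD d'
  simD d d' (stepL r) = let (e , s) = combD-L d r in inj₁ s ◅ ε ≡⟶ irrD e d'
  simD (comp c) d' st = simC c d' st
  simD zer d' st = ⊥-elim (zer-normal st)
  simD (scal _ _) _ (stepAl ())
  simD (scal _ _) _ (stepAr ())
  simD (plus _ _) _ (stepAl ())
  simD (plus _ _) _ (stepAr ())
  simD (scal α d) (scal .α e) (scal _ st) = under* _ (scal α) (simD d e st)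
  simD (plus d₁ d₂) (plus e₁ e₂) (sumL _ st) =
    under* _ (sumL _) (simD d₁ e₁ st) ≡⟶ cong (_ ⊕_) (irrD d₂ e₂)
  simD (plus d₁ d₂) (plus e₁ e₂) (sumR _ st) =
    under* _ (sumR _) (simD d₂ e₂ st) ≡⟶ cong (_⊕ _) (irrD d₁ e₁)

lemma4p7 : ∀ {c ℓ} (R : Ring c ℓ) → let open Lambda R in
    ∀ {D D' : Term} (d : IsD [] D) (d' : IsD [] D') →
    D ⟶lβ D' → barD d ⟶aβ* barD d'
lemma4p7 R d d' step = simD d d' (toStep step)
  where open Simulation R
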